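{- Let $G$ be a witness graph for a VAS $\vec{A}\subseteq\mathbb{Z}^d$. The following are equivalent: (1) $G$ is reversible; (2) $\vec{Z}_G$ is a subgroup of $(\mathbb{Z}^d,+)$; (3) the zero vector is the displacement of a total Kirchhoff function for $G$.
   Context: Let $\star$ be a new symbol, $\mathbb{N}_\star=\mathbb{N}\cup\{\star\}$; for $I\subseteq\{1,\ldots,d\}$, $\mathbb{N}_I^d$ is the set of $\vec{c}\in\mathbb{N}_\star^d$ with $\{i\mid\vec{c}(i)=\star\}=I$. For $\vec{a}\in\mathbb{Z}^d$, $\pi_I(\vec{a})$ replaces the components in $I$ by $\star$, and addition is componentwise outside $I$. A VAS is a finite $\vec{A}\subseteq\mathbb{Z}^d$. A subreachability graph is $G=(\vec{Q},T)$ with $\vec{Q}\subseteq\mathbb{N}_I^d$ a nonempty finite set of states and $T\subseteq\vec{Q}\times\vec{A}\times\vec{Q}$ a finite set of transitions $(\vec{x},\vec{a},\vec{y})$ with $\vec{y}=\vec{x}+\pi_I(\vec{a})$; a witness graph is a strongly connected subreachability graph. A path $\vec{x}\xrightarrow{\sigma}_G\vec{y}$ labelled by $\sigma=\vec{a}_1\cdots\vec{a}_k$ is a sequence of transitions $(\vec{c}_{j-1},\vec{a}_j,\vec{c}_j)\in T$ with $\vec{c}_0=\vec{x}$, $\vec{c}_k=\vec{y}$; it is a cycle if $\vec{x}=\vec{y}$. $\Delta(\sigma)=\sum_j\vec{a}_j\in\mathbb{Z}^d$. $\vec{Z}_G$ is the set of finite sums of $\Delta(\sigma)$ with $\sigma$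 labelling a cycle of $G$. $G$ is reversible if for every path $\vec{x}\xrightarrow{u}_G\vec{y}$ there is a path $\vec{y}\xrightarrow{v}_G\vec{x}$ with $\Delta(u)+\Delta(v)=\vec{0}$. A Kirchhoff function for $G$ is $\mu:T\to\mathbb{N}$ such that at every state the sum of $\mu$ over incoming transitions equals the sum over outgoing transitions; it is total if $\mu(t)\geq1$ for all $t\in T$; its displacement is $\sum_{t=(\vec{x},\vec{a},\vec{y})\in T}\mu(t)\vec{a}$. -}

module Defs where

open import Data.Nat using (ℕ; zero; suc; _≤_)
open import Data.Integer using (ℤ; +_; _+_; -_; _*_)
open import Data.Fin using (Fin)
open import Data.Fin.Subset using (Subset; _∈_)
open import Data.Maybe using (Maybe; just; nothing)
import Data.Maybe.Properties as MaybeP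
import Data.Nat.Properties as NatP
open import Data.Vec using (Vec; lookup; replicate; zipWith; map)
import Data.Vec.Properties as VecP
open import Data.List using (List; []; _∷_; length; foldr)
import Data.List as L
import Data.Nat.ListAction as NLA
open import Data.List.Membership.Propositional using () renaming (_∈_ to _∈L_)
open import Data.List.Relation.Unary.All using (All)
open import Data.List.Relation.Unary.Unique.Propositional using (Unique)
open import Data.Product using (Σ; ∃; ∃-syntax; _×_; _,_; proj₁; proj₂)
open import Data.Unit using (⊤)
open import Data.Empty using (⊥)
open import Relation.Binary.PropositionalEquality using (_≡_)
open import Relation.Nullary using (yes; no)
open import Relation.Binary.Definitions using (DecidableEquality)

-- ℕ_⋆ = ℕ ∪ {⋆}, with ⋆ represented by 'nothing'
ℕ⋆ : Set
ℕ⋆ = Maybe ℕ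

Conf : ℕ → Set
Conf d = Vec ℕ⋆ d

ZVec : ℕ → Set
ZVec d = Vec ℤ d

_≟C_ : ∀ {d} → DecidableEquality (Conf d)
_≟C_ = VecP.≡-dec (MaybeP.≡-dec NatP._≟_)

0ᵛ : ∀ {d} → ZVec d
0ᵛ = replicate _ (+ 0)

_+ᵛ_ : ∀ {d} → ZVec d → ZVec d → ZVec d
_+ᵛ_ = zipWith _+_

-ᵛ_ : ∀ {d} → ZVec d → ZVec d
-ᵛ_ = map -_

_·ᵛ_ : ∀ {d} → ℕ → ZVec d → ZVec d
n ·ᵛ v = map (λ z → (+ n) * z) v

InNI : ∀ {d} → Subset d → Conf d → Set
InNI {d} I c = (i : Fin d) → (lookup c i ≡ nothing → i ∈ I) × (i ∈ I → lookup c i ≡ nothing)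

-- componentwise: y(i) = x(i) + π_I(a)(i)  (⋆ + anything = ⋆; otherwise integer addition)
StepComp : ℕ⋆ → ℤ → ℕ⋆ → Set
StepComp nothing  a nothing  = ⊤
StepComp (just m) a (just n) = + n ≡ + m + a
StepComp _        _ _        = ⊥

Step : ∀ {d} → Conf d → ZVec d → Conf d → Set
Step {d} x a y = (i : Fin d) → StepComp (lookup x i) (lookup a i) (lookup y i)

record Trans (d : ℕ) : Set where
  constructor tr
  field
    src   : Conf d
    label : ZVec d
    tgt   : Conf d
open Trans public

-- subreachability graph G = (Q, T) for the VAS A (a finite set given as a list)
-- with states in ℕ_I^d; finite sets are duplicate-free lists
record SubreachGraph (d : ℕ) (A : List (ZVec d)) (I : Subset d) : Set where
  field
    states        : List (Conf d)
    states-nonempty : Σ (Conf d) (λ q → q ∈L states)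
    states-unique : Unique states
    states-NI     : All (InNI I) states
    trans         : List (Trans d)
    trans-unique  : Unique trans
    trans-valid   : All (λ t → (src t ∈L states) × (label t ∈L A) × (tgt t ∈L states)
                                 × Step (src t) (label t) (tgt t)) trans
open SubreachGraph public

module _ {d : ℕ} {A : List (ZVec d)} {I : Subset d} (G : SubreachGraph d A I) where

  data Path : Conf d → Conf d → List (ZVec d) → Set where
    [] : ∀ {x} → Path x x []
    step : ∀ {x z y a σ} → tr x a z ∈L trans G → Path z y σ → Path x y (a ∷ σ)

  StronglyConnected : Set
  StronglyConnected = ∀ x y → x ∈L states G → y ∈L states G → ∃[ σ ] Path x y σ

  IsWitnessGraph : Set
  IsWitnessGraph = StronglyConnected

Δ : ∀ {d} → List (ZVec d) → ZVec d
Δ = foldr _+ᵛ_ 0ᵛ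

module _ {d : ℕ} {A : List (ZVec d)} {I : Subset d} (G : SubreachGraph d A I) where

  data InZ : ZVec d → Set where
    zero-sum : InZ 0ᵛ
    add-cycle : ∀ {x σ z} → Path G x x σ → InZ z → InZ (Δ σ +ᵛ z)

  Reversible : Set
  Reversible = ∀ {x y u} → Path G x y u → ∃[ v ] (Path G y x v × (Δ u +ᵛ Δ v ≡ 0ᵛ))

  -- Kirchhoff functions μ : T → ℕ, T indexed by positions in the duplicate-free list
  TIdx : Set
  TIdx = Fin (length (trans G))

  tAt : TIdx → Trans d
  tAt = L.lookup (trans G)

  sumℕ : (TIdx → ℕ) → ℕ
  sumℕ f = NLA.sum (L.map f (L.allFin _))

  inflow : (TIdx → ℕ) → Conf d → ℕ
  inflow μ q = sumℕ (λ i → case-eq (tgt (tAt i)) q (μ i))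
    where
      case-eq : Conf d → Conf d → ℕ → ℕ
      case-eq a b n with a ≟C b
      ... | yes _ = n
      ... | no _  = 0

  outflow : (TIdx → ℕ) → Conf d → ℕ
  outflow μ q = sumℕ (λ i → case-eq (src (tAt i)) q (μ i))
    where
      case-eq : Conf d → Conf d → ℕ → ℕ
      case-eq a b n with a ≟C b
      ... | yes _ = n
      ... | no _  = 0

  IsKirchhoff : (TIdx → ℕ) → Set
  IsKirchhoff μ = All (λ q → inflow μ q ≡ outflow μ q) (states G)

  IsTotal : (TIdx → ℕ) → Set
  IsTotal μ = (i : TIdx) → 1 ≤ μ i

  displacement : (TIdx → ℕ) → ZVec d
  displacement μ = foldr _+ᵛ_ 0ᵛ (L.map (λ i → μ i ·ᵛ label (tAt i)) (L.allFin _))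

  ZeroIsTotalKirchhoffDisplacement : Set
  ZeroIsTotalKirchhoffDisplacement =
    Σ (TIdx → ℕ) λ μ → IsKirchhoff μ × IsTotal μ × (displacement μ ≡ 0ᵛ)

IsSubgroup : ∀ {d} → (ZVec d → Set) → Set
IsSubgroup {d} P = P 0ᵛ × (∀ {x y} → P x → P y → P (x +ᵛ y)) × (∀ {x} → P x → P (-ᵛ x))

-- The displacement of a Kirchhoff function always lies in Z_G: by induction
-- on its mass, a unit flow from x to y is a path from x to y plus cycles, and
-- a nonzero Kirchhoff function is a transition t plus a unit flow from tgt t
-- back to src t.  As Z_G is the submonoid generated by cycle displacements,
-- (2) amounts to −Δ σ ∈ Z_G for every cycle σ.
-- (1) ⇒ (2): a reverse of σ is a cycle with displacement −Δ σ.
-- (3) ⇒ (2): if μ is total Kirchhoff with displacement 0 and π is the Parikh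
-- vector of σ, then (mass π) μ − π is Kirchhoff with displacement −Δ σ.
-- (2) ⇒ (3): sum the Parikh vectors of cycles through all transitions and add
-- a Kirchhoff function realising the inverse of the resulting displacement.
-- (2) ⇒ (1): splicing cycles into fixed round trips from x to every state
-- realises each element of Z_G by a single cycle at x; to reverse u : x → y,
-- go back to x by some w and follow the cycle realising −(Δ u + Δ w).

module Submission where

open import Defs
open import Level using (Level)
open import Algebra.Bundles using (AbelianGroup; CommutativeMonoid)
open import Algebra.Structures using (IsAbelianGroup)
import Algebra.Properties.CommutativeSemigroup
import Algebra.Solver.CommutativeMonoid
open import Data.Bool using (if_then_else_)
open import Data.Nat as ℕ using (ℕ; zero; suc; _≤_; z≤n; s≤s)
import Data.Nat.Properties as ℕP
open import Data.Integer as ℤ using (+_)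
import Data.Integer.Properties as ℤP
open import Data.Fin as Fin using (Fin)
import Data.Fin.Properties as FinP
open import Data.Fin.Subset using (Subset)
open import Data.Vec using ([]; _∷_)
import Data.Vec.Properties as VecP
import Data.Vec.Functional as Vector
open import Data.List as List using (List)
import Data.List.Properties as ListP
open import Data.List.Relation.Unary.All as All using (All; []; _∷_)
open import Data.List.Relation.Unary.Any as Any using (here; there)
import Data.List.Relation.Unary.Any.Properties as AnyP
open import Data.List.Membership.Propositional using () renaming (_∈_ to _∈L_)
open import Data.List.Membership.Propositional.Properties using (∈-lookup; ∈-allFin)
open import Data.Product as Product using (Σ; _×_; _,_; ∃-syntax; proj₁; proj₂)
open import Function.Bundles using (_⇔_; mk⇔)
open import Relation.Binary.Definitions using (DecidableEquality)
open import Relation.Binary.PropositionalEquality using (_≡_; refl; sym; cong; cong₂; subst; module ≡-Reasoning)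
import Relation.Binary.PropositionalEquality as ≡
open import Relation.Nullary using (does; yes; no; ¬_)
open import Relation.Nullary.Negation using (contradiction)

private
  variable
    c ℓ ℓ′ : Level
    A B : Set ℓ′
    d n : ℕ

+ᵛ-0ᵛ-isAbelianGroup : IsAbelianGroup _≡_ (_+ᵛ_ {d}) 0ᵛ -ᵛ_
+ᵛ-0ᵛ-isAbelianGroup = record
  { isGroup = record
    { isMonoid = record
      { isSemigroup = record
        { isMagma = record { isEquivalence = ≡.isEquivalence ; ∙-cong = cong₂ _+ᵛ_ }
        ; assoc = VecP.zipWith-assoc ℤP.+-assoc }
      ; identity = VecP.zipWith-identityˡ ℤP.+-identityˡ , VecP.zipWith-identityʳ ℤP.+-identityʳ }
    ; inverse = VecP.zipWith-inverseˡ ℤP.+-inverseˡ , VecP.zipWith-inverseʳ ℤP.+-inverseʳ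
    ; ⁻¹-cong = cong -ᵛ_ }
  ; comm = VecP.zipWith-comm ℤP.+-comm }

+ᵛ-0ᵛ-abelianGroup : ℕ → AbelianGroup _ _
+ᵛ-0ᵛ-abelianGroup d = record { isAbelianGroup = +ᵛ-0ᵛ-isAbelianGroup {d} }

+ᵛ-0ᵛ-commutativeMonoid : ℕ → CommutativeMonoid _ _
+ᵛ-0ᵛ-commutativeMonoid d = AbelianGroup.commutativeMonoid (+ᵛ-0ᵛ-abelianGroup d)

·ᵛ-zero : (v : ZVec d) → 0 ·ᵛ v ≡ 0ᵛ
·ᵛ-zero []      = refl
·ᵛ-zero (_ ∷ v) = cong (+ 0 ∷_) (·ᵛ-zero v)

·ᵛ-suc : ∀ k (v : ZVec d) → suc k ·ᵛ v ≡ v +ᵛ (k ·ᵛ v)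
·ᵛ-suc k []      = refl
·ᵛ-suc k (z ∷ v) = cong₂ _∷_ +[1+k]z≡z+kz (·ᵛ-suc k v)
  where
  +[1+k]z≡z+kz : + suc k ℤ.* z ≡ z ℤ.+ + k ℤ.* z
  +[1+k]z≡z+kz = begin
    + suc k ℤ.* z             ≡⟨ cong (ℤ._* z) (ℤP.pos-+ 1 k) ⟩
    (+ 1 ℤ.+ + k) ℤ.* z       ≡⟨ ℤP.*-distribʳ-+ z (+ 1) (+ k) ⟩
    + 1 ℤ.* z ℤ.+ + k ℤ.* z   ≡⟨ cong (ℤ._+ + k ℤ.* z) (ℤP.*-identityˡ z) ⟩
    z ℤ.+ + k ℤ.* z           ∎
    where open ≡-Reasoning

kronecker : DecidableEquality A → A → A → ℕ
kronecker _≟_ x y = if does (x ≟ y) then 1 else 0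

module _ (_≟_ : DecidableEquality A) where

  kronecker-refl : ∀ x → kronecker _≟_ x x ≡ 1
  kronecker-refl x with x ≟ x
  ... | yes _  = refl
  ... | no x≢x = contradiction refl x≢x

  kronecker-≢ : ∀ {x y} → ¬ x ≡ y → kronecker _≟_ x y ≡ 0
  kronecker-≢ {x} {y} x≢y with x ≟ y
  ... | yes x≡y = contradiction x≡y x≢y
  ... | no _    = refl

index-∈-lookup : (xs : List A) (i : Fin (List.length xs)) → Any.index (∈-lookup {xs = xs} i) ≡ i
index-∈-lookup (_ List.∷ xs) Fin.zero    = refl
index-∈-lookup (_ List.∷ xs) (Fin.suc i) = cong Fin.suc (index-∈-lookup xs i)

foldr-tabulate : (f : A → B → B) (e : B) (g : Fin n → A) →
                 List.foldr f e (List.tabulate g) ≡ Vector.foldr f e g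
foldr-tabulate {n = zero}  f e g = refl
foldr-tabulate {n = suc n} f e g = cong (f (g Fin.zero)) (foldr-tabulate f e (λ i → g (Fin.suc i)))

infixl 6 _⊕_ _⊝_
infixl 7 _⊛_

_⊕_ _⊝_ : (Fin n → ℕ) → (Fin n → ℕ) → Fin n → ℕ
(ν ⊕ μ) i = ν i ℕ.+ μ i
(ν ⊝ μ) i = ν i ℕ.∸ μ i

_⊛_ : ℕ → (Fin n → ℕ) → Fin n → ℕ
(k ⊛ ν) i = k ℕ.* ν i

⊝-⊕-cancel : {ν μ : Fin n → ℕ} → (∀ i → μ i ≤ ν i) → ∀ i → (ν ⊝ μ ⊕ μ) i ≡ ν i
⊝-⊕-cancel μ≤ν i = ℕP.m∸n+n≡m (μ≤ν i)

basis : Fin n → Fin n → ℕ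
basis = kronecker Fin._≟_

_⊖_ : (Fin n → ℕ) → Fin n → Fin n → ℕ
ν ⊖ t = ν ⊝ basis t

⊖-split : (ν : Fin n → ℕ) {t : Fin n} → 1 ≤ ν t → ∀ j → ν j ≡ (basis t ⊕ ν ⊖ t) j
⊖-split ν {t} 1≤νt j with t Fin.≟ j
... | yes refl = sym (ℕP.m+[n∸m]≡n 1≤νt)
... | no _     = refl

module WeightedSum (M : CommutativeMonoid c ℓ) where
  open CommutativeMonoid M
    using (Carrier; _≈_; setoid; monoid; rawMonoid; ∙-cong; ∙-congˡ; identityˡ; identityʳ; reflexive)
    renaming (_∙_ to _+_; ε to 0#; refl to ≈-refl; trans to ≈-trans)
  open import Algebra.Definitions.RawMonoid rawMonoid public using (sum) renaming (_×_ to _·_)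
  open import Algebra.Properties.Monoid.Mult monoid using (×-homo-1; ×-homo-+)
  open import Algebra.Properties.Monoid.Sum monoid using (sum-cong-≋; sum-replicate-zero)
  open import Algebra.Properties.CommutativeMonoid.Sum M using (∑-distrib-+)
  open import Relation.Binary.Reasoning.Setoid setoid

  sum-allFin : (f : Fin n → Carrier) → List.foldr _+_ 0# (List.map f (List.allFin n)) ≡ sum f
  sum-allFin f = ≡.trans (cong (List.foldr _+_ 0#) (ListP.map-tabulate (λ i → i) f)) (foldr-tabulate _+_ 0# f)

  sum-cong : {f g : Fin n → Carrier} → (∀ i → f i ≈ g i) → sum f ≈ sum g
  sum-cong = sum-cong-≋

  sum-zero : (f : Fin n → Carrier) → (∀ i → f i ≈ 0#) → sum f ≈ 0#
  sum-zero {n} f f≈0 = ≈-trans (sum-cong f≈0) (sum-replicate-zero n)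

  sum-single : (f : Fin n → Carrier) (t : Fin n) → (∀ j → ¬ j ≡ t → f j ≈ 0#) → sum f ≈ f t
  sum-single f Fin.zero f≈0 = begin
    f Fin.zero + sum (λ j → f (Fin.suc j)) ≈⟨ ∙-congˡ (sum-zero _ (λ j → f≈0 (Fin.suc j) λ ())) ⟩
    f Fin.zero + 0#                        ≈⟨ identityʳ _ ⟩
    f Fin.zero                             ∎
  sum-single f (Fin.suc t) f≈0 = begin
    f Fin.zero + sum (λ j → f (Fin.suc j)) ≈⟨ ∙-cong (f≈0 Fin.zero λ ()) (sum-single _ t off-t) ⟩
    0# + f (Fin.suc t)                     ≈⟨ identityˡ _ ⟩
    f (Fin.suc t)                          ∎
    where
    off-t : ∀ j → ¬ j ≡ t → f (Fin.suc j) ≈ 0#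
    off-t j j≢t = f≈0 (Fin.suc j) (λ sj≡st → j≢t (FinP.suc-injective sj≡st))

  ·-zeroʳ : ∀ k → k · 0# ≈ 0#
  ·-zeroʳ zero    = ≈-refl
  ·-zeroʳ (suc k) = ≈-trans (identityˡ _) (·-zeroʳ k)

  weighted : (Fin n → ℕ) → (Fin n → Carrier) → Carrier
  weighted ν w = sum λ i → ν i · w i

  module Linearity {n} {F : (Fin n → ℕ) → Carrier} {w : Fin n → Carrier}
                   (F≈weighted : ∀ ν → F ν ≈ weighted ν w) where

    ≗-cong : ∀ {ν μ} → (∀ i → ν i ≡ μ i) → F ν ≈ F μ
    ≗-cong {ν} {μ} ν≗μ = begin
      F ν          ≈⟨ F≈weighted ν ⟩
      weighted ν w ≈⟨ sum-cong (λ i → reflexive (cong (_· w i) (ν≗μ i))) ⟩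
      weighted μ w ≈⟨ F≈weighted μ ⟨
      F μ          ∎

    zero-homo : F (λ _ → 0) ≈ 0#
    zero-homo = ≈-trans (F≈weighted _) (sum-zero {n} _ (λ _ → ≈-refl))

    ⊕-homo : ∀ ν μ → F (ν ⊕ μ) ≈ F ν + F μ
    ⊕-homo ν μ = begin
      F (ν ⊕ μ)                    ≈⟨ F≈weighted (ν ⊕ μ) ⟩
      weighted (ν ⊕ μ) w           ≈⟨ sum-cong (λ i → ×-homo-+ (w i) (ν i) (μ i)) ⟩
      sum (λ i → ν i · w i + μ i · w i) ≈⟨ ∑-distrib-+ (λ i → ν i · w i) (λ i → μ i · w i) ⟩
      weighted ν w + weighted μ w  ≈⟨ ∙-cong (F≈weighted ν) (F≈weighted μ) ⟨
      F ν + F μ                    ∎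

    ⊛-homo : ∀ k ν → F (k ⊛ ν) ≈ k · F ν
    ⊛-homo zero    ν = zero-homo
    ⊛-homo (suc k) ν = ≈-trans (⊕-homo ν (k ⊛ ν)) (∙-congˡ (⊛-homo k ν))

    basis-homo : ∀ t → F (basis t) ≈ w t
    basis-homo t = begin
      F (basis t)             ≈⟨ F≈weighted (basis t) ⟩
      weighted (basis t) w    ≈⟨ sum-single _ t off-t ⟩
      basis t t · w t         ≡⟨ cong (_· w t) (kronecker-refl Fin._≟_ t) ⟩
      1 · w t                 ≈⟨ ×-homo-1 (w t) ⟩
      w t                     ∎
      where
      off-t : ∀ j → ¬ j ≡ t → basis t j · w j ≈ 0#
      off-t j j≢t rewrite kronecker-≢ Fin._≟_ (λ t≡j → j≢t (sym t≡j)) = ≈-refl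

    ⊖-homo : ∀ ν {t} → 1 ≤ ν t → F ν ≈ w t + F (ν ⊖ t)
    ⊖-homo ν {t} 1≤νt = begin
      F ν                     ≈⟨ ≗-cong (⊖-split ν 1≤νt) ⟩
      F (basis t ⊕ ν ⊖ t)     ≈⟨ ⊕-homo (basis t) (ν ⊖ t) ⟩
      F (basis t) + F (ν ⊖ t) ≈⟨ ∙-cong (basis-homo t) ≈-refl ⟩
      w t + F (ν ⊖ t)         ∎

module ℕΣ = WeightedSum ℕP.+-0-commutativeMonoid
module ℕCS = Algebra.Properties.CommutativeSemigroup ℕP.+-commutativeSemigroup

·-is-* : ∀ m k → m ℕΣ.· k ≡ m ℕ.* k
·-is-* zero    k = refl
·-is-* (suc m) k = cong (k ℕ.+_) (·-is-* m k)

≤-sum : (f : Fin n → ℕ) (i : Fin n) → f i ≤ ℕΣ.sum f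
≤-sum f Fin.zero    = ℕP.m≤m+n _ _
≤-sum f (Fin.suc i) = ℕP.≤-trans (≤-sum (λ j → f (Fin.suc j)) i) (ℕP.m≤n+m _ _)

sum≡0⇒≗0 : (f : Fin n → ℕ) → ℕΣ.sum f ≡ 0 → ∀ i → f i ≡ 0
sum≡0⇒≗0 f Σf≡0 i = ℕP.n≤0⇒n≡0 (subst (f i ≤_) Σf≡0 (≤-sum f i))

sum-positive : (f : Fin n → ℕ) → 1 ≤ ℕΣ.sum f → ∃[ i ] 1 ≤ f i
sum-positive {suc n} f 1≤Σf with f Fin.zero in f0≡
... | suc _ = Fin.zero , subst (1 ≤_) (sym f0≡) (s≤s z≤n)
... | zero  = Product.map Fin.suc (λ 1≤ → 1≤) (sum-positive (λ j → f (Fin.suc j)) 1≤Σf)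

·-identityʳ : ∀ k → k ℕΣ.· 1 ≡ k
·-identityʳ k = ≡.trans (·-is-* k 1) (ℕP.*-identityʳ k)

mass : (Fin n → ℕ) → ℕ
mass = ℕΣ.sum

module Mass {n} = ℕΣ.Linearity {n} {F = mass} {w = λ _ → 1}
  (λ ν → ℕΣ.sum-cong λ i → sym (·-identityʳ (ν i)))

mass-⊖ : ∀ {m} (ν : Fin n → ℕ) {t} → 1 ≤ ν t → mass ν ≡ suc m → mass (ν ⊖ t) ≡ m
mass-⊖ ν 1≤νt mass≡ = ℕP.suc-injective (≡.trans (sym (Mass.⊖-homo ν 1≤νt)) mass≡)

module _ {d : ℕ} where
  open AbelianGroup (+ᵛ-0ᵛ-abelianGroup d)
    using ()
    renaming (assoc to +ᵛ-assoc; identityˡ to +ᵛ-identityˡ;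
              identityʳ to +ᵛ-identityʳ; inverseʳ to +ᵛ-inverseʳ)
  open import Algebra.Properties.AbelianGroup (+ᵛ-0ᵛ-abelianGroup d)
    using (⁻¹-∙-comm; inverseˡ-unique; inverseʳ-unique; ε⁻¹≈ε; \\-leftDividesˡ)
  module ℤᵈΣ = WeightedSum (+ᵛ-0ᵛ-commutativeMonoid d)
  module +ᵛ-Solver = Algebra.Solver.CommutativeMonoid (+ᵛ-0ᵛ-commutativeMonoid d)
  module +ᵛ-CS = Algebra.Properties.CommutativeSemigroup (AbelianGroup.commutativeSemigroup (+ᵛ-0ᵛ-abelianGroup d))

  ·ᵛ-is-· : ∀ k (v : ZVec d) → k ·ᵛ v ≡ k ℤᵈΣ.· v
  ·ᵛ-is-· zero    v = ·ᵛ-zero v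
  ·ᵛ-is-· (suc k) v = ≡.trans (·ᵛ-suc k v) (cong (v +ᵛ_) (·ᵛ-is-· k v))

  Δ-++ : (σ τ : List (ZVec d)) → Δ (σ List.++ τ) ≡ Δ σ +ᵛ Δ τ
  Δ-++ List.[]       τ = sym (+ᵛ-identityˡ (Δ τ))
  Δ-++ (a List.∷ σ) τ = ≡.trans (cong (a +ᵛ_) (Δ-++ σ τ)) (sym (+ᵛ-assoc a (Δ σ) (Δ τ)))

  module _ {A : List (ZVec d)} {I : Subset d} (G : SubreachGraph d A I) where

    δˢ : Conf d → Conf d → ℕ
    δˢ = kronecker _≟C_

    -- The summands are the local case-eq of Defs.inflow (resp. outflow), which
    -- cannot be named; the meta in their type is solved by the use above them.
    mutual
      inflow-weighted : ∀ q ν → inflow G ν q ≡ ℕΣ.weighted ν (λ t → δˢ (tgt (tAt G t)) q)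
      inflow-weighted q ν = ≡.trans (ℕΣ.sum-allFin {n = List.length (trans G)} _) (ℕΣ.sum-cong (inflow-summand q ν))

      inflow-summand : ∀ q ν t → _ ≡ ν t ℕΣ.· δˢ (tgt (tAt G t)) q
      inflow-summand q ν t with tgt (tAt G t) ≟C q
      ... | yes _ = sym (·-identityʳ (ν t))
      ... | no _  = sym (ℕΣ.·-zeroʳ (ν t))

    mutual
      outflow-weighted : ∀ q ν → outflow G ν q ≡ ℕΣ.weighted ν (λ t → δˢ (src (tAt G t)) q)
      outflow-weighted q ν = ≡.trans (ℕΣ.sum-allFin {n = List.length (trans G)} _) (ℕΣ.sum-cong (outflow-summand q ν))

      outflow-summand : ∀ q ν t → _ ≡ ν t ℕΣ.· δˢ (src (tAt G t)) q
      outflow-summand q ν t with src (tAt G t) ≟C q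
      ... | yes _ = sym (·-identityʳ (ν t))
      ... | no _  = sym (ℕΣ.·-zeroʳ (ν t))

    displacement-weighted : ∀ ν → displacement G ν ≡ ℤᵈΣ.weighted ν (λ t → label (tAt G t))
    displacement-weighted ν = ≡.trans (ℤᵈΣ.sum-allFin {n = List.length (trans G)} _) (ℤᵈΣ.sum-cong λ t → ·ᵛ-is-· (ν t) _)

    endpoints∈states : ∀ {t} → t ∈L trans G → src t ∈L states G × tgt t ∈L states G
    endpoints∈states t∈ with All.lookup (trans-valid G) t∈
    ... | src∈ , _ , tgt∈ , _ = src∈ , tgt∈

    module Inflow (q : Conf d) = ℕΣ.Linearity (inflow-weighted q)
    module Outflow (q : Conf d) = ℕΣ.Linearity (outflow-weighted q)
    module Displacement = ℤᵈΣ.Linearity displacement-weighted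

    private
      variable
        x y z : Conf d
        σ τ : List (ZVec d)
        ν μ : TIdx G → ℕ

    _++ᵖ_ : Path G x y σ → Path G y z τ → Path G x z (σ List.++ τ)
    []         ++ᵖ q = q
    step t∈ p ++ᵖ q = step t∈ (p ++ᵖ q)

    path-target∈states : Path G x y σ → x ∈L states G → y ∈L states G
    path-target∈states []         x∈ = x∈
    path-target∈states (step t∈ p) _ = path-target∈states p (endpoints∈states t∈ .proj₂)

    parikh : Path G x y σ → TIdx G → ℕ
    parikh []          = λ _ → 0
    parikh (step t∈ p) = basis (Any.index t∈) ⊕ parikh p

    tAt-index : ∀ {t} (t∈ : t ∈L trans G) → tAt G (Any.index t∈) ≡ t
    tAt-index t∈ = sym (AnyP.lookup-index t∈)

    FlowBalance : (TIdx G → ℕ) → Conf d → Conf d → Conf d → Set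
    FlowBalance ν x y s = inflow G ν s ℕ.+ δˢ x s ≡ outflow G ν s ℕ.+ δˢ y s

    IsUnitFlow : Conf d → Conf d → (TIdx G → ℕ) → Set
    IsUnitFlow x y ν = All (FlowBalance ν x y) (states G)

    parikh-balance : (p : Path G x y σ) → ∀ s → FlowBalance (parikh p) x y s
    parikh-balance []                     s = cong (ℕ._+ _) (≡.trans (Inflow.zero-homo s) (sym (Outflow.zero-homo s)))
    parikh-balance {x} {y} (step {z = z} t∈ p) s = begin
      inflow G (basis k ⊕ parikh p) s ℕ.+ δˢ x s          ≡⟨ cong (ℕ._+ δˢ x s) (Inflow.⊕-homo s (basis k) (parikh p)) ⟩
      (inflow G (basis k) s ℕ.+ inflow G (parikh p) s) ℕ.+ δˢ x s ≡⟨ cong (λ i → (i ℕ.+ _) ℕ.+ δˢ x s) in-k ⟩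
      (δˢ z s ℕ.+ inflow G (parikh p) s) ℕ.+ δˢ x s       ≡⟨ ℕCS.xy∙z≈z∙yx (δˢ z s) _ (δˢ x s) ⟩
      δˢ x s ℕ.+ (inflow G (parikh p) s ℕ.+ δˢ z s)       ≡⟨ cong (δˢ x s ℕ.+_) (parikh-balance p s) ⟩
      δˢ x s ℕ.+ (outflow G (parikh p) s ℕ.+ δˢ y s)      ≡⟨ ℕP.+-assoc (δˢ x s) _ (δˢ y s) ⟨
      (δˢ x s ℕ.+ outflow G (parikh p) s) ℕ.+ δˢ y s      ≡⟨ cong (λ o → (o ℕ.+ _) ℕ.+ δˢ y s) out-k ⟨
      (outflow G (basis k) s ℕ.+ outflow G (parikh p) s) ℕ.+ δˢ y s ≡⟨ cong (ℕ._+ δˢ y s) (Outflow.⊕-homo s (basis k) (parikh p)) ⟨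
      outflow G (basis k ⊕ parikh p) s ℕ.+ δˢ y s         ∎
      where
      open ≡-Reasoning
      k : TIdx G
      k = Any.index t∈
      in-k : inflow G (basis k) s ≡ δˢ z s
      in-k = ≡.trans (Inflow.basis-homo s k) (cong (λ t → δˢ (tgt t) s) (tAt-index t∈))
      out-k : outflow G (basis k) s ≡ δˢ x s
      out-k = ≡.trans (Outflow.basis-homo s k) (cong (λ t → δˢ (src t) s) (tAt-index t∈))

    unitFlow-loop⇒kirchhoff : IsUnitFlow x x ν → IsKirchhoff G ν
    unitFlow-loop⇒kirchhoff {x} = All.map λ {s} → ℕP.+-cancelʳ-≡ (δˢ x s) _ _

    parikh-kirchhoff : (p : Path G x x σ) → IsKirchhoff G (parikh p)
    parikh-kirchhoff {x} p = unitFlow-loop⇒kirchhoff {x} (All.tabulate λ {s} _ → parikh-balance p s)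

    displacement-parikh : (p : Path G x y σ) → displacement G (parikh p) ≡ Δ σ
    displacement-parikh []          = Displacement.zero-homo
    displacement-parikh (step t∈ p) = ≡.trans (Displacement.⊕-homo (basis k) (parikh p))
      (cong₂ _+ᵛ_ (≡.trans (Displacement.basis-homo k) (cong label (tAt-index t∈))) (displacement-parikh p))
      where
      k : TIdx G
      k = Any.index t∈

    InZ-+ : ∀ {u v} → InZ G u → InZ G v → InZ G (u +ᵛ v)
    InZ-+ {v = v} zero-sum v∈ = subst (InZ G) (sym (+ᵛ-identityˡ v)) v∈
    InZ-+ {v = v} (add-cycle {σ = σ} {z = z} p z∈) v∈ =
      subst (InZ G) (sym (+ᵛ-assoc (Δ σ) z v)) (add-cycle p (InZ-+ z∈ v∈))

    cycle∈Z : Path G x x σ → InZ G (Δ σ)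
    cycle∈Z {σ = σ} p = subst (InZ G) (+ᵛ-identityʳ (Δ σ)) (add-cycle p zero-sum)

    kirchhoff-zero : IsKirchhoff G (λ _ → 0)
    kirchhoff-zero = All.tabulate λ {s} _ → ≡.trans (Inflow.zero-homo s) (sym (Outflow.zero-homo s))

    kirchhoff-⊕ : IsKirchhoff G ν → IsKirchhoff G μ → IsKirchhoff G (ν ⊕ μ)
    kirchhoff-⊕ {ν} {μ} kν kμ = All.tabulate λ {s} s∈ → begin
      inflow G (ν ⊕ μ) s                     ≡⟨ Inflow.⊕-homo s ν μ ⟩
      inflow G ν s ℕ.+ inflow G μ s          ≡⟨ cong₂ ℕ._+_ (All.lookup kν s∈) (All.lookup kμ s∈) ⟩
      outflow G ν s ℕ.+ outflow G μ s        ≡⟨ Outflow.⊕-homo s ν μ ⟨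
      outflow G (ν ⊕ μ) s                    ∎
      where open ≡-Reasoning

    kirchhoff-⊛ : ∀ k → IsKirchhoff G ν → IsKirchhoff G (k ⊛ ν)
    kirchhoff-⊛ {ν} k kν = All.tabulate λ {s} s∈ → begin
      inflow G (k ⊛ ν) s       ≡⟨ Inflow.⊛-homo s k ν ⟩
      k ℕΣ.· inflow G ν s      ≡⟨ cong (k ℕΣ.·_) (All.lookup kν s∈) ⟩
      k ℕΣ.· outflow G ν s     ≡⟨ Outflow.⊛-homo s k ν ⟨
      outflow G (k ⊛ ν) s      ∎
      where open ≡-Reasoning

    kirchhoff-⊝ : (∀ t → μ t ≤ ν t) → IsKirchhoff G ν → IsKirchhoff G μ → IsKirchhoff G (ν ⊝ μ)
    kirchhoff-⊝ {μ} {ν} μ≤ν kν kμ = All.tabulate λ {s} s∈ → ℕP.+-cancelʳ-≡ (inflow G μ s) _ _ (begin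
      inflow G (ν ⊝ μ) s ℕ.+ inflow G μ s    ≡⟨ Inflow.⊕-homo s (ν ⊝ μ) μ ⟨
      inflow G (ν ⊝ μ ⊕ μ) s                 ≡⟨ Inflow.≗-cong s (⊝-⊕-cancel μ≤ν) ⟩
      inflow G ν s                           ≡⟨ All.lookup kν s∈ ⟩
      outflow G ν s                          ≡⟨ Outflow.≗-cong s (⊝-⊕-cancel μ≤ν) ⟨
      outflow G (ν ⊝ μ ⊕ μ) s                ≡⟨ Outflow.⊕-homo s (ν ⊝ μ) μ ⟩
      outflow G (ν ⊝ μ) s ℕ.+ outflow G μ s  ≡⟨ cong (outflow G (ν ⊝ μ) s ℕ.+_) (All.lookup kμ s∈) ⟨
      outflow G (ν ⊝ μ) s ℕ.+ inflow G μ s   ∎)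
      where open ≡-Reasoning

    displacement-⊝ : (∀ t → μ t ≤ ν t) → displacement G (ν ⊝ μ) +ᵛ displacement G μ ≡ displacement G ν
    displacement-⊝ {μ} {ν} μ≤ν =
      ≡.trans (sym (Displacement.⊕-homo (ν ⊝ μ) μ)) (Displacement.≗-cong (⊝-⊕-cancel μ≤ν))

    ·δˢ-positive : ∀ k a b → 1 ≤ k ℕΣ.· δˢ a b → a ≡ b × 1 ≤ k
    ·δˢ-positive k a b 1≤ with a ≟C b
    ... | yes a≡b = a≡b , subst (1 ≤_) (·-identityʳ k) 1≤
    ... | no _    = contradiction (subst (1 ≤_) (ℕΣ.·-zeroʳ k) 1≤) λ ()

    outflow-positive : 1 ≤ outflow G ν x → ∃[ t ] src (tAt G t) ≡ x × 1 ≤ ν t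
    outflow-positive {ν} {x} 1≤out with sum-positive _ (subst (1 ≤_) (outflow-weighted x ν) 1≤out)
    ... | t , 1≤νt·δ = t , ·δˢ-positive (ν t) _ x 1≤νt·δ

    unitFlow-stuck : x ∈L states G → IsUnitFlow x y ν → outflow G ν x ≡ 0 → x ≡ y
    unitFlow-stuck {x} {y} {ν} x∈ flow out≡0 with x ≟C y
    ... | yes x≡y = x≡y
    ... | no x≢y  = contradiction in+1≡0 (ℕP.m+1+n≢0 (inflow G ν x))
      where
      open ≡-Reasoning
      in+1≡0 : inflow G ν x ℕ.+ 1 ≡ 0
      in+1≡0 = begin
        inflow G ν x ℕ.+ 1        ≡⟨ cong (inflow G ν x ℕ.+_) (kronecker-refl _≟C_ x) ⟨
        inflow G ν x ℕ.+ δˢ x x   ≡⟨ All.lookup flow x∈ ⟩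
        outflow G ν x ℕ.+ δˢ y x  ≡⟨ cong₂ ℕ._+_ out≡0 (kronecker-≢ _≟C_ (λ y≡x → x≢y (sym y≡x))) ⟩
        0                          ∎

    unitFlow-⊖-source : ∀ {t} → IsUnitFlow (src (tAt G t)) y ν → 1 ≤ ν t → IsUnitFlow (tgt (tAt G t)) y (ν ⊖ t)
    unitFlow-⊖-source {y} {ν} {t} flow 1≤νt = All.tabulate λ {s} s∈ →
      ℕP.+-cancelʳ-≡ (δˢ u s) _ _ (begin
        (inflow G (ν ⊖ t) s ℕ.+ δˢ v s) ℕ.+ δˢ u s   ≡⟨ cong (ℕ._+ δˢ u s) (ℕP.+-comm _ (δˢ v s)) ⟩
        (δˢ v s ℕ.+ inflow G (ν ⊖ t) s) ℕ.+ δˢ u s   ≡⟨ cong (ℕ._+ δˢ u s) (Inflow.⊖-homo s ν 1≤νt) ⟨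
        inflow G ν s ℕ.+ δˢ u s                       ≡⟨ All.lookup flow s∈ ⟩
        outflow G ν s ℕ.+ δˢ y s                      ≡⟨ cong (ℕ._+ δˢ y s) (Outflow.⊖-homo s ν 1≤νt) ⟩
        (δˢ u s ℕ.+ outflow G (ν ⊖ t) s) ℕ.+ δˢ y s  ≡⟨ ℕCS.xy∙z≈y∙zx (δˢ u s) _ _ ⟩
        outflow G (ν ⊖ t) s ℕ.+ (δˢ y s ℕ.+ δˢ u s)  ≡⟨ ℕP.+-assoc _ (δˢ y s) (δˢ u s) ⟨
        (outflow G (ν ⊖ t) s ℕ.+ δˢ y s) ℕ.+ δˢ u s  ∎)
      where
      open ≡-Reasoning
      u v : Conf d
      u = src (tAt G t)
      v = tgt (tAt G t)

    kirchhoff-⊖ : ∀ {t} → IsKirchhoff G ν → 1 ≤ ν t → IsUnitFlow (tgt (tAt G t)) (src (tAt G t)) (ν ⊖ t)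
    kirchhoff-⊖ {ν} {t} kν 1≤νt = All.tabulate λ {s} s∈ → begin
      inflow G (ν ⊖ t) s ℕ.+ δˢ v s    ≡⟨ ℕP.+-comm _ (δˢ v s) ⟩
      δˢ v s ℕ.+ inflow G (ν ⊖ t) s    ≡⟨ Inflow.⊖-homo s ν 1≤νt ⟨
      inflow G ν s                      ≡⟨ All.lookup kν s∈ ⟩
      outflow G ν s                     ≡⟨ Outflow.⊖-homo s ν 1≤νt ⟩
      δˢ u s ℕ.+ outflow G (ν ⊖ t) s   ≡⟨ ℕP.+-comm (δˢ u s) _ ⟩
      outflow G (ν ⊖ t) s ℕ.+ δˢ u s   ∎
      where
      open ≡-Reasoning
      u v : Conf d
      u = src (tAt G t)
      v = tgt (tAt G t)

    PathWithCycles : Conf d → Conf d → (TIdx G → ℕ) → Set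
    PathWithCycles x y ν = ∃[ σ ] Path G x y σ × ∃[ z ] InZ G z × displacement G ν ≡ Δ σ +ᵛ z

    prepend-transition : ∀ t → 1 ≤ ν t → PathWithCycles (tgt (tAt G t)) y (ν ⊖ t) →
                         PathWithCycles (src (tAt G t)) y ν
    prepend-transition {ν} t 1≤νt (σ , p , z , z∈ , eq) =
      a List.∷ σ , step (∈-lookup t) p , z , z∈ , (begin
        displacement G ν                 ≡⟨ Displacement.⊖-homo ν 1≤νt ⟩
        a +ᵛ displacement G (ν ⊖ t)      ≡⟨ cong (a +ᵛ_) eq ⟩
        a +ᵛ (Δ σ +ᵛ z)                  ≡⟨ +ᵛ-assoc a (Δ σ) z ⟨
        (a +ᵛ Δ σ) +ᵛ z                  ∎)
      where
      open ≡-Reasoning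
      a : ZVec d
      a = label (tAt G t)

    src∈states : ∀ t → src (tAt G t) ∈L states G
    src∈states t = endpoints∈states (∈-lookup t) .proj₁

    tgt∈states : ∀ t → tgt (tAt G t) ∈L states G
    tgt∈states t = endpoints∈states (∈-lookup t) .proj₂

    mutual
      unitFlow-decomposes : ∀ m → mass ν ≡ m → x ∈L states G → IsUnitFlow x y ν → PathWithCycles x y ν
      unitFlow-decomposes {ν} {x} {y} m mass≡m x∈ flow with 1 ℕ.≤? outflow G ν x
      ... | yes 1≤out with outflow-positive 1≤out
      ...   | t , src≡x , 1≤νt =
        subst (λ x → PathWithCycles x y ν) src≡x
              (leave-through m t mass≡m 1≤νt (subst (λ x → IsUnitFlow x y ν) (sym src≡x) flow))
      unitFlow-decomposes {ν} {x} {y} m mass≡m x∈ flow | no ¬1≤out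
        with unitFlow-stuck {x} {y} {ν} x∈ flow (ℕP.n<1⇒n≡0 (ℕP.≰⇒> ¬1≤out))
      ... | refl = List.[] , [] , displacement G ν ,
                   kirchhoff-displacement∈Z m mass≡m (unitFlow-loop⇒kirchhoff {x} flow) ,
                   sym (+ᵛ-identityˡ _)

      leave-through : ∀ m t → mass ν ≡ m → 1 ≤ ν t → IsUnitFlow (src (tAt G t)) y ν →
                      PathWithCycles (src (tAt G t)) y ν
      leave-through {ν} zero    t mass≡0 1≤νt flow = contradiction (≡.trans (sym mass≡0) (Mass.⊖-homo ν 1≤νt)) ℕP.0≢1+n
      leave-through {ν} {y} (suc m) t mass≡ 1≤νt flow = prepend-transition t 1≤νt
        (unitFlow-decomposes m (mass-⊖ ν 1≤νt mass≡) (tgt∈states t) (unitFlow-⊖-source {y} {ν} flow 1≤νt))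

      kirchhoff-displacement∈Z : ∀ m → mass ν ≡ m → IsKirchhoff G ν → InZ G (displacement G ν)
      kirchhoff-displacement∈Z {ν} zero mass≡0 _ =
        subst (InZ G) (sym (≡.trans (Displacement.≗-cong (sum≡0⇒≗0 ν mass≡0)) Displacement.zero-homo)) zero-sum
      kirchhoff-displacement∈Z {ν} (suc m) mass≡ kν with sum-positive ν (subst (1 ≤_) (sym mass≡) (s≤s z≤n))
      ... | t , 1≤νt with prepend-transition t 1≤νt
                (unitFlow-decomposes m (mass-⊖ ν 1≤νt mass≡) (tgt∈states t) (kirchhoff-⊖ kν 1≤νt))
      ...   | σ , p , z , z∈ , eq = subst (InZ G) (sym eq) (add-cycle p z∈)

    negated-cycles⇒subgroup : (∀ {x σ} → Path G x x σ → InZ G (-ᵛ Δ σ)) → IsSubgroup (InZ G)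
    negated-cycles⇒subgroup −cycle∈Z = zero-sum , InZ-+ , negate
      where
      negate : ∀ {z} → InZ G z → InZ G (-ᵛ z)
      negate zero-sum                         = subst (InZ G) (sym ε⁻¹≈ε) zero-sum
      negate (add-cycle {σ = σ} {z = z} p z∈) = subst (InZ G) (⁻¹-∙-comm (Δ σ) z) (InZ-+ (−cycle∈Z p) (negate z∈))

    reversible⇒subgroup : Reversible G → IsSubgroup (InZ G)
    reversible⇒subgroup reversible = negated-cycles⇒subgroup −cycle∈Z
      where
      −cycle∈Z : Path G x x σ → InZ G (-ᵛ Δ σ)
      −cycle∈Z {σ = σ} p with reversible p
      ... | υ , q , Δσ+Δυ≡0 = subst (InZ G) (inverseʳ-unique (Δ σ) (Δ υ) Δσ+Δυ≡0) (cycle∈Z q)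

    zeroTotalKirchhoff⇒subgroup : ZeroIsTotalKirchhoffDisplacement G → IsSubgroup (InZ G)
    zeroTotalKirchhoff⇒subgroup (μ , kμ , μ-total , μ-balanced) = negated-cycles⇒subgroup −cycle∈Z
      where
      −cycle∈Z : Path G x x σ → InZ G (-ᵛ Δ σ)
      −cycle∈Z {σ = σ} p = subst (InZ G) displacement≡−Δσ
        (kirchhoff-displacement∈Z (mass ν₋) refl (kirchhoff-⊝ π≤Mμ (kirchhoff-⊛ M kμ) (parikh-kirchhoff p)))
        where
        π : TIdx G → ℕ
        π = parikh p
        M : ℕ
        M = mass π
        ν₋ : TIdx G → ℕ
        ν₋ = M ⊛ μ ⊝ π
        π≤Mμ : ∀ t → π t ≤ (M ⊛ μ) t
        π≤Mμ t = ℕP.≤-trans (≤-sum π t) (subst (_≤ M ℕ.* μ t) (ℕP.*-identityʳ M) (ℕP.*-monoʳ-≤ M (μ-total t)))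
        displacement≡−Δσ : displacement G ν₋ ≡ -ᵛ Δ σ
        displacement≡−Δσ = inverseˡ-unique (displacement G ν₋) (Δ σ) (begin
          displacement G ν₋ +ᵛ Δ σ               ≡⟨ cong (displacement G ν₋ +ᵛ_) (displacement-parikh p) ⟨
          displacement G ν₋ +ᵛ displacement G π  ≡⟨ displacement-⊝ π≤Mμ ⟩
          displacement G (M ⊛ μ)                ≡⟨ Displacement.⊛-homo M μ ⟩
          M ℤᵈΣ.· displacement G μ              ≡⟨ cong (M ℤᵈΣ.·_) μ-balanced ⟩
          M ℤᵈΣ.· 0ᵛ                            ≡⟨ ℤᵈΣ.·-zeroʳ M ⟩
          0ᵛ                                    ∎)
          where open ≡-Reasoning

    kirchhoff-add-cycle : (p : Path G x x σ) → IsKirchhoff G ν →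
      IsKirchhoff G (parikh p ⊕ ν) × displacement G (parikh p ⊕ ν) ≡ Δ σ +ᵛ displacement G ν
    kirchhoff-add-cycle {ν = ν} p kν =
      kirchhoff-⊕ (parikh-kirchhoff p) kν ,
      ≡.trans (Displacement.⊕-homo (parikh p) ν) (cong (_+ᵛ displacement G ν) (displacement-parikh p))

    Z⇒kirchhoff : ∀ {z} → InZ G z → ∃[ ν ] IsKirchhoff G ν × displacement G ν ≡ z
    Z⇒kirchhoff zero-sum = (λ _ → 0) , kirchhoff-zero , Displacement.zero-homo
    Z⇒kirchhoff (add-cycle p z∈) with Z⇒kirchhoff z∈
    ... | ν , kν , refl = parikh p ⊕ ν , kirchhoff-add-cycle p kν

    cycle-through : StronglyConnected G → ∀ t →
      ∃[ σ ] Σ (Path G (src (tAt G t)) (src (tAt G t)) σ) λ p → 1 ≤ parikh p t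
    cycle-through sc t with sc (tgt (tAt G t)) (src (tAt G t)) (tgt∈states t) (src∈states t)
    ... | σ , p = label (tAt G t) List.∷ σ , step (∈-lookup t) p ,
                  ℕP.≤-trans (ℕP.≤-reflexive (sym basis-t)) (ℕP.m≤m+n _ (parikh p t))
      where
      basis-t : basis (Any.index (∈-lookup {xs = trans G} t)) t ≡ 1
      basis-t = ≡.trans (cong (λ k → basis k t) (index-∈-lookup (trans G) t)) (kronecker-refl Fin._≟_ t)

    covering-kirchhoff : StronglyConnected G → (ts : List (TIdx G)) →
      ∃[ ν ] IsKirchhoff G ν × InZ G (displacement G ν) × All (λ t → 1 ≤ ν t) ts
    covering-kirchhoff sc List.[] =
      (λ _ → 0) , kirchhoff-zero , subst (InZ G) (sym Displacement.zero-homo) zero-sum , []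
    covering-kirchhoff sc (t List.∷ ts) with cycle-through sc t | covering-kirchhoff sc ts
    ... | σ , p , 1≤pt | ν , kν , ν∈Z , ν-covers with kirchhoff-add-cycle p kν
    ...   | kν′ , ν′≡ =
      parikh p ⊕ ν , kν′ , subst (InZ G) (sym ν′≡) (InZ-+ (cycle∈Z p) ν∈Z) ,
      ℕP.≤-trans 1≤pt (ℕP.m≤m+n _ (ν t)) ∷ All.map (λ 1≤νt′ → ℕP.≤-trans 1≤νt′ (ℕP.m≤n+m _ _)) ν-covers

    subgroup⇒zeroTotalKirchhoff : StronglyConnected G → IsSubgroup (InZ G) → ZeroIsTotalKirchhoffDisplacement G
    subgroup⇒zeroTotalKirchhoff sc (_ , _ , −∈Z) with covering-kirchhoff sc (List.allFin _)
    ... | ν₁ , kν₁ , ν₁∈Z , ν₁-covers with Z⇒kirchhoff (−∈Z ν₁∈Z)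
    ...   | ν₂ , kν₂ , ν₂≡− =
      ν₁ ⊕ ν₂ ,
      kirchhoff-⊕ kν₁ kν₂ ,
      (λ t → ℕP.≤-trans (All.lookup ν₁-covers (∈-allFin t)) (ℕP.m≤m+n _ _)) ,
      ≡.trans (Displacement.⊕-homo ν₁ ν₂) (≡.trans (cong (displacement G ν₁ +ᵛ_) ν₂≡−) (+ᵛ-inverseʳ _))

    CycleAt : Conf d → Set
    CycleAt s = ∃[ σ ] Path G s s σ

    ΣΔ : ∀ {ss} → All CycleAt ss → ZVec d
    ΣΔ []             = 0ᵛ
    ΣΔ ((σ , _) ∷ cs) = Δ σ +ᵛ ΣΔ cs

    empty-cycles : ∀ ss → Σ (All CycleAt ss) λ cs → ΣΔ cs ≡ 0ᵛ
    empty-cycles List.[]       = [] , refl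
    empty-cycles (_ List.∷ ss) with empty-cycles ss
    ... | cs , ΣΔ≡0 = (List.[] , []) ∷ cs , ≡.trans (+ᵛ-identityˡ (ΣΔ cs)) ΣΔ≡0

    insert-cycle : ∀ {s ss} → s ∈L ss → Path G s s σ → (cs : All CycleAt ss) →
                   Σ (All CycleAt ss) λ cs′ → ΣΔ cs′ ≡ Δ σ +ᵛ ΣΔ cs
    insert-cycle {σ} (here refl) p ((σ₀ , p₀) ∷ cs) =
      (σ₀ List.++ σ , p₀ ++ᵖ p) ∷ cs ,
      ≡.trans (cong (_+ᵛ ΣΔ cs) (Δ-++ σ₀ σ)) (+ᵛ-CS.xy∙z≈y∙xz (Δ σ₀) (Δ σ) (ΣΔ cs))
    insert-cycle {σ} (there s∈) p ((σ₀ , p₀) ∷ cs) with insert-cycle s∈ p cs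
    ... | cs′ , ΣΔcs′≡ = (σ₀ , p₀) ∷ cs′ , ≡.trans (cong (Δ σ₀ +ᵛ_) ΣΔcs′≡) (+ᵛ-CS.x∙yz≈y∙xz (Δ σ₀) (Δ σ) (ΣΔ cs))

    Z⇒cycles-at-states : ∀ {z} → InZ G z → Σ (All CycleAt (states G)) λ cs → ΣΔ cs ≡ z
    Z⇒cycles-at-states zero-sum = empty-cycles (states G)
    Z⇒cycles-at-states (add-cycle {z = z} [] z∈) with Z⇒cycles-at-states z∈
    ... | cs , ΣΔcs≡z = cs , ≡.trans ΣΔcs≡z (sym (+ᵛ-identityˡ z))
    Z⇒cycles-at-states (add-cycle p@(step t∈ _) z∈) with Z⇒cycles-at-states z∈
    ... | cs , ΣΔcs≡z with insert-cycle (endpoints∈states t∈ .proj₁) p cs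
    ...   | cs′ , ΣΔcs′≡ = cs′ , ≡.trans ΣΔcs′≡ (cong (_ +ᵛ_) ΣΔcs≡z)

    RoundTrip : Conf d → Conf d → Set
    RoundTrip x s = (∃[ ρ ] Path G x s ρ) × (∃[ ρ′ ] Path G s x ρ′)

    roundTripsΔ : ∀ {ss} → All (RoundTrip x) ss → ZVec d
    roundTripsΔ []                       = 0ᵛ
    roundTripsΔ (((ρ , _) , (ρ′ , _)) ∷ rts) = (Δ ρ +ᵛ Δ ρ′) +ᵛ roundTripsΔ rts

    tour : ∀ {ss} (rts : All (RoundTrip x) ss) (cs : All CycleAt ss) →
           ∃[ τ ] Path G x x τ × Δ τ ≡ roundTripsΔ rts +ᵛ ΣΔ cs
    tour [] [] = List.[] , [] , sym (+ᵛ-identityˡ 0ᵛ)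
    tour (((ρ , r) , (ρ′ , r′)) ∷ rts) ((σ , c) ∷ cs) with tour rts cs
    ... | τ , t , Δτ≡ = ρ List.++ (σ List.++ (ρ′ List.++ τ)) , r ++ᵖ (c ++ᵖ (r′ ++ᵖ t)) , (begin
      Δ (ρ List.++ (σ List.++ (ρ′ List.++ τ)))        ≡⟨ ≡.trans (Δ-++ ρ _) (cong (Δ ρ +ᵛ_) (≡.trans (Δ-++ σ _) (cong (Δ σ +ᵛ_) (Δ-++ ρ′ τ)))) ⟩
      Δ ρ +ᵛ (Δ σ +ᵛ (Δ ρ′ +ᵛ Δ τ))                  ≡⟨ cong (λ e → Δ ρ +ᵛ (Δ σ +ᵛ (Δ ρ′ +ᵛ e))) Δτ≡ ⟩
      Δ ρ +ᵛ (Δ σ +ᵛ (Δ ρ′ +ᵛ (R +ᵛ C)))             ≡⟨ +ᵛ-Solver.solve 5 (λ a b c e f → a ⊞ (b ⊞ (c ⊞ (e ⊞ f))) ⊜ ((a ⊞ c) ⊞ e) ⊞ (b ⊞ f)) refl (Δ ρ) (Δ σ) (Δ ρ′) R C ⟩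
      ((Δ ρ +ᵛ Δ ρ′) +ᵛ R) +ᵛ (Δ σ +ᵛ C)             ∎)
      where
      open ≡-Reasoning
      open +ᵛ-Solver using (_⊜_) renaming (_⊕_ to _⊞_)
      R C : ZVec d
      R = roundTripsΔ rts
      C = ΣΔ cs

    -- T is the displacement of a fixed family of round trips x → s → x, one per
    -- state s; the cycles at s representing an element of Z_G are spliced in.
    closed-walks-realise-Z : StronglyConnected G → x ∈L states G →
      ∃[ T ] InZ G T × (∀ {z} → InZ G z → ∃[ τ ] Path G x x τ × Δ τ ≡ T +ᵛ z)
    closed-walks-realise-Z {x} sc x∈ = roundTripsΔ rts , T∈Z , realise
      where
      rts : All (RoundTrip x) (states G)
      rts = All.tabulate λ s∈ → sc x _ x∈ s∈ , sc _ x s∈ x∈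
      realise : ∀ {z} → InZ G z → ∃[ τ ] Path G x x τ × Δ τ ≡ roundTripsΔ rts +ᵛ z
      realise z∈ with Z⇒cycles-at-states z∈
      ... | cs , ΣΔcs≡z with tour rts cs
      ...   | τ , t , Δτ≡ = τ , t , ≡.trans Δτ≡ (cong (roundTripsΔ rts +ᵛ_) ΣΔcs≡z)
      T∈Z : InZ G (roundTripsΔ rts)
      T∈Z with realise zero-sum
      ... | τ , t , Δτ≡ = subst (InZ G) (≡.trans Δτ≡ (+ᵛ-identityʳ _)) (cycle∈Z t)

    subgroup⇒cycle-realises : StronglyConnected G → IsSubgroup (InZ G) → x ∈L states G →
      ∀ {z} → InZ G z → ∃[ τ ] Path G x x τ × Δ τ ≡ z
    subgroup⇒cycle-realises sc (_ , +∈Z , −∈Z) x∈ {z} z∈ with closed-walks-realise-Z sc x∈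
    ... | T , T∈Z , realise with realise (+∈Z (−∈Z T∈Z) z∈)
    ...   | τ , t , Δτ≡ = τ , t , ≡.trans Δτ≡ (\\-leftDividesˡ T z)

    subgroup⇒reversible : StronglyConnected G → IsSubgroup (InZ G) → Reversible G
    subgroup⇒reversible sc subgroup [] = List.[] , [] , +ᵛ-identityˡ 0ᵛ
    subgroup⇒reversible sc subgroup@(_ , _ , −∈Z) {x} {y} {u} p@(step t∈ _) =
      return (sc y x (path-target∈states p x∈) x∈)
      where
      x∈ : x ∈L states G
      x∈ = endpoints∈states t∈ .proj₁
      return : ∃[ w ] Path G y x w → ∃[ v ] Path G y x v × Δ u +ᵛ Δ v ≡ 0ᵛ
      return (w , q) with subgroup⇒cycle-realises sc subgroup x∈ (−∈Z (subst (InZ G) (Δ-++ u w) (cycle∈Z (p ++ᵖ q))))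
      ... | τ , t , Δτ≡−D = w List.++ τ , q ++ᵖ t , (begin
        Δ u +ᵛ Δ (w List.++ τ)             ≡⟨ cong (Δ u +ᵛ_) (Δ-++ w τ) ⟩
        Δ u +ᵛ (Δ w +ᵛ Δ τ)                ≡⟨ +ᵛ-assoc (Δ u) (Δ w) (Δ τ) ⟨
        (Δ u +ᵛ Δ w) +ᵛ Δ τ                ≡⟨ cong ((Δ u +ᵛ Δ w) +ᵛ_) Δτ≡−D ⟩
        (Δ u +ᵛ Δ w) +ᵛ (-ᵛ (Δ u +ᵛ Δ w))  ≡⟨ +ᵛ-inverseʳ (Δ u +ᵛ Δ w) ⟩
        0ᵛ                                 ∎)
        where open ≡-Reasoning

lemma7p2 : (d : ℕ) (A : List (ZVec d)) (I : Subset d) (G : SubreachGraph d A I) →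
    IsWitnessGraph G →
    (Reversible G ⇔ IsSubgroup (InZ G)) × (IsSubgroup (InZ G) ⇔ ZeroIsTotalKirchhoffDisplacement G)
lemma7p2 d A I G sc =
  mk⇔ (reversible⇒subgroup G) (subgroup⇒reversible G sc) ,
  mk⇔ (subgroup⇒zeroTotalKirchhoff G sc) (zeroTotalKirchhoff⇒subgroup G)
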